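{- Let $n\ge 2$ be an even integer. In every saturated pure partial plane of order $n$ there is a point that lies on at least $3$ lines.
   Context: A pure partial plane of order $n$ and size $s$ is a set $X$ of $n^2+n+1$ points together with a collection of $s$ distinct lines, each line being a subset of $X$ of cardinality $n+1$, such that any two distinct lines intersect in exactly one point. It is saturated if no $(n+1)$-subset of $X$ other than the existing lines meets every existing line in exactly one point (so no line can be added keeping it a pure partial plane). -}

module Defs where

open import Data.Nat using (ℕ; suc; _+_; _*_; _≤_)
open import Data.Fin using (Fin)
open import Data.Fin.Subset using (Subset; _∩_; ∣_∣)
open import Data.Vec using (tabulate; lookup)
open import Data.Product using (Σ; ∃; _×_)
open import Relation.Binary.PropositionalEquality using (_≡_; _≢_)

numPoints : ℕ → ℕ
numPoints n = n * n + n + 1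

Point : ℕ → Set
Point n = Fin (numPoints n)

Line : ℕ → Set
Line n = Subset (numPoints n)

record IsPurePartialPlane (n s : ℕ) (L : Fin s → Line n) : Set where
  field
    lineSize : ∀ i → ∣ L i ∣ ≡ suc n
    distinct : ∀ i j → i ≢ j → L i ≢ L j
    meetOnce : ∀ i j → i ≢ j → ∣ L i ∩ L j ∣ ≡ 1

IsSaturated : (n s : ℕ) → (Fin s → Line n) → Set
IsSaturated n s L =
  ∀ (M : Line n) → ∣ M ∣ ≡ suc n → (∀ i → ∣ M ∩ L i ∣ ≡ 1) → ∃ λ i → M ≡ L i

linesThrough : ∀ n {s} → (Fin s → Line n) → Point n → Subset s
linesThrough n L p = tabulate (λ i → lookup (L i) p)

-- Suppose no point lies on three lines.  Then a line meets the other s - 1 lines in s - 1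
-- distinct points, so s ≤ n + 2 and the lines cover exactly s(n+1) - C(s,2) points.  If
-- s ≤ n + 1, every line has a point on no other line; if s = n + 2, then s is even, and we pair
-- the lines up and take the meeting point of each pair.  Either way we get a set T of at most
-- n + 1 covered points meeting every line exactly once, and the count leaves enough uncovered
-- points to pad T to an (n+1)-set.  That set meets every line once but is not a line,
-- contradicting saturation.
module Submission where

open import Defs
open import Data.Nat using (ℕ; zero; suc; _+_; _*_; _∸_; _≤_; _<_; _≤?_; z≤n; s≤s)
open import Data.Nat.Properties hiding (_≟_; suc-injective)
open import Data.Nat.Combinatorics using (_C_; nC1≡n; nCk+nC[k+1]≡[n+1]C[k+1])
open import Data.Nat.Tactic.RingSolver using (solve-∀)
open import Data.Fin using (Fin; zero; suc; _≟_; punchIn; punchOut; combine; quotient; remainder)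
open import Data.Fin.Properties
  using (suc-injective; punchInᵢ≢i; punchIn-injective; punchIn-punchOut; combine-injectiveʳ;
         combine-remQuot; remQuot-combine; any?)
open import Data.Fin.Subset
open import Data.Fin.Subset.Properties
open import Data.Vec using ([]; _∷_; here; there; lookup)
open import Data.Vec.Properties using ([]=⇒lookup; lookup⇒[]=; lookup∘tabulate)
open import Data.Product using (∃; _×_; _,_; proj₁; proj₂)
open import Data.Sum using (inj₁; inj₂)
open import Data.Empty using (⊥-elim)
open import Function using (id; _∘_)
open import Function.Definitions using (Injective)
open import Relation.Nullary using (¬_; yes; no; contradiction)
open import Relation.Binary.PropositionalEquality

private variable
  m k : ℕ
  p q : Subset m
  x y : Fin m

∣p∪q∣+∣p∩q∣≡∣p∣+∣q∣ : (p q : Subset m) → ∣ p ∪ q ∣ + ∣ p ∩ q ∣ ≡ ∣ p ∣ + ∣ q ∣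
∣p∪q∣+∣p∩q∣≡∣p∣+∣q∣ []            []            = refl
∣p∪q∣+∣p∩q∣≡∣p∣+∣q∣ (inside  ∷ p) (inside  ∷ q) =
  cong suc (trans (+-suc _ _) (trans (cong suc (∣p∪q∣+∣p∩q∣≡∣p∣+∣q∣ p q)) (sym (+-suc _ _))))
∣p∪q∣+∣p∩q∣≡∣p∣+∣q∣ (inside  ∷ p) (outside ∷ q) = cong suc (∣p∪q∣+∣p∩q∣≡∣p∣+∣q∣ p q)
∣p∪q∣+∣p∩q∣≡∣p∣+∣q∣ (outside ∷ p) (inside  ∷ q) = trans (cong suc (∣p∪q∣+∣p∩q∣≡∣p∣+∣q∣ p q)) (sym (+-suc _ _))
∣p∪q∣+∣p∩q∣≡∣p∣+∣q∣ (outside ∷ p) (outside ∷ q) = ∣p∪q∣+∣p∩q∣≡∣p∣+∣q∣ p q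

Empty⇒∣p∣≡0 : Empty p → ∣ p ∣ ≡ 0
Empty⇒∣p∣≡0 {m} p-empty rewrite Empty-unique p-empty = ∣⊥∣≡0 m

∣p∪q∣≡∣p∣+∣q∣ : (p q : Subset m) → Empty (p ∩ q) → ∣ p ∪ q ∣ ≡ ∣ p ∣ + ∣ q ∣
∣p∪q∣≡∣p∣+∣q∣ p q disjoint = begin
  ∣ p ∪ q ∣               ≡⟨ +-identityʳ _ ⟨
  ∣ p ∪ q ∣ + 0           ≡⟨ cong (∣ p ∪ q ∣ +_) (Empty⇒∣p∣≡0 disjoint) ⟨
  ∣ p ∪ q ∣ + ∣ p ∩ q ∣   ≡⟨ ∣p∪q∣+∣p∩q∣≡∣p∣+∣q∣ p q ⟩
  ∣ p ∣ + ∣ q ∣           ∎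
  where open ≡-Reasoning

x∈p⇒0<∣p∣ : x ∈ p → 0 < ∣ p ∣
x∈p⇒0<∣p∣ {x = x} x∈p = ≤-trans (≤-reflexive (sym (∣⁅x⁆∣≡1 x)))
  (p⊆q⇒∣p∣≤∣q∣ λ y∈⁅x⁆ → subst (_∈ _) (sym (x∈⁅y⁆⇒x≡y x y∈⁅x⁆)) x∈p)

0<∣p∣⇒Nonempty : 0 < ∣ p ∣ → Nonempty p
0<∣p∣⇒Nonempty {p = p} 0<∣p∣ with nonempty? p
... | yes p-nonempty = p-nonempty
... | no  p-empty    = contradiction (Empty⇒∣p∣≡0 p-empty) (>⇒≢ 0<∣p∣)

∣p∣≡1⇒∈-unique : ∣ p ∣ ≡ 1 → x ∈ p → y ∈ p → x ≡ y
∣p∣≡1⇒∈-unique {x = x} {y = y} ∣p∣≡1 x∈p y∈p with x ≟ y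
... | yes x≡y = x≡y
... | no  x≢y = contradiction 1<∣p∣ (<-irrefl (sym ∣p∣≡1))
  where
  1<∣p∣ = ≤-trans (s≤s (x∈p⇒0<∣p∣ (x∈p∧x≢y⇒x∈p-y y∈p (x≢y ∘ sym)))) (x∈p⇒∣p-x∣<∣p∣ x∈p)

∈-unique⇒∣p∣≡1 : x ∈ p → (∀ {y} → y ∈ p → y ≡ x) → ∣ p ∣ ≡ 1
∈-unique⇒∣p∣≡1 {x = x} x∈p unique = trans (cong ∣_∣ p≡⁅x⁆) (∣⁅x⁆∣≡1 x)
  where
  p≡⁅x⁆ = ⊆-antisym (λ y∈p → subst (_∈ ⁅ x ⁆) (sym (unique y∈p)) (x∈⁅x⁆ x))
                    (λ y∈⁅x⁆ → subst (_∈ _) (sym (x∈⁅y⁆⇒x≡y x y∈⁅x⁆)) x∈p)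

private
  there-∈∉ : ∀ {s t} → (∃ λ x → x ∈ p × x ∉ q) → ∃ λ x → x ∈ s ∷ p × x ∉ t ∷ q
  there-∈∉ (x , x∈p , x∉q) = suc x , there x∈p , x∉q ∘ drop-there

∣q∣<∣p∣⇒∃∈p∉q : (p q : Subset m) → ∣ q ∣ < ∣ p ∣ → ∃ λ x → x ∈ p × x ∉ q
∣q∣<∣p∣⇒∃∈p∉q (inside  ∷ p) (outside ∷ q) _             = zero , here , λ ()
∣q∣<∣p∣⇒∃∈p∉q (inside  ∷ p) (inside  ∷ q) (s≤s ∣q∣<∣p∣) = there-∈∉ (∣q∣<∣p∣⇒∃∈p∉q p q ∣q∣<∣p∣)
∣q∣<∣p∣⇒∃∈p∉q (outside ∷ p) (inside  ∷ q) 1+∣q∣<∣p∣     = there-∈∉ (∣q∣<∣p∣⇒∃∈p∉q p q (<⇒≤ 1+∣q∣<∣p∣))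
∣q∣<∣p∣⇒∃∈p∉q (outside ∷ p) (outside ∷ q) ∣q∣<∣p∣       = there-∈∉ (∣q∣<∣p∣⇒∃∈p∉q p q ∣q∣<∣p∣)

subsetOfSize : (p : Subset m) (t : ℕ) → t ≤ ∣ p ∣ → ∃ λ q → q ⊆ p × ∣ q ∣ ≡ t
subsetOfSize         []            zero    _           = [] , (λ ()) , refl
subsetOfSize {suc m} (inside  ∷ p) zero    _           = ⊥ , ⊥⊆ , ∣⊥∣≡0 (suc m)
subsetOfSize         (inside  ∷ p) (suc t) (s≤s t≤∣p∣) with subsetOfSize p t t≤∣p∣
... | q , q⊆p , ∣q∣≡t = inside ∷ q , s⊆s q⊆p , cong suc ∣q∣≡t
subsetOfSize         (outside ∷ p) t       t≤∣p∣       with subsetOfSize p t t≤∣p∣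
... | q , q⊆p , ∣q∣≡t = outside ∷ q , s⊆s q⊆p , ∣q∣≡t

⋃ᶠ : (Fin k → Subset m) → Subset m
⋃ᶠ {zero}  F = ⊥
⋃ᶠ {suc k} F = F zero ∪ ⋃ᶠ (F ∘ suc)

∈⋃ᶠ⁺ : (F : Fin k → Subset m) (i : Fin k) → x ∈ F i → x ∈ ⋃ᶠ F
∈⋃ᶠ⁺ {suc k} F zero    x∈F₀ = p⊆p∪q _ x∈F₀
∈⋃ᶠ⁺ {suc k} F (suc i) x∈Fᵢ = q⊆p∪q (F zero) _ (∈⋃ᶠ⁺ (F ∘ suc) i x∈Fᵢ)

∈⋃ᶠ⁻ : (F : Fin k → Subset m) → x ∈ ⋃ᶠ F → ∃ λ i → x ∈ F i
∈⋃ᶠ⁻ {zero}  F x∈⊥ = contradiction x∈⊥ ∉⊥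
∈⋃ᶠ⁻ {suc k} F x∈⋃ with x∈p∪q⁻ (F zero) _ x∈⋃
... | inj₁ x∈F₀ = zero , x∈F₀
... | inj₂ x∈⋃′ with ∈⋃ᶠ⁻ (F ∘ suc) x∈⋃′
...   | i , x∈Fᵢ = suc i , x∈Fᵢ

image : (Fin k → Fin m) → Subset m
image f = ⋃ᶠ (⁅_⁆ ∘ f)

∈image⁺ : (f : Fin k → Fin m) (i : Fin k) → f i ∈ image f
∈image⁺ f i = ∈⋃ᶠ⁺ (⁅_⁆ ∘ f) i (x∈⁅x⁆ (f i))

∈image⁻ : (f : Fin k → Fin m) → x ∈ image f → ∃ λ i → x ≡ f i
∈image⁻ f x∈ with ∈⋃ᶠ⁻ (⁅_⁆ ∘ f) x∈
... | i , x∈⁅fi⁆ = i , x∈⁅y⁆⇒x≡y (f i) x∈⁅fi⁆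

∣image∣≡k : (f : Fin k → Fin m) → Injective _≡_ _≡_ f → ∣ image f ∣ ≡ k
∣image∣≡k {zero}  {m} f _     = ∣⊥∣≡0 m
∣image∣≡k {suc k}     f f-inj = begin
  ∣ ⁅ f zero ⁆ ∪ image (f ∘ suc) ∣      ≡⟨ ∣p∪q∣≡∣p∣+∣q∣ ⁅ f zero ⁆ _ disjoint ⟩
  ∣ ⁅ f zero ⁆ ∣ + ∣ image (f ∘ suc) ∣  ≡⟨ cong₂ _+_ (∣⁅x⁆∣≡1 (f zero))
                                                       (∣image∣≡k (f ∘ suc) (suc-injective ∘ f-inj)) ⟩
  suc k                                 ∎
  where
  open ≡-Reasoning
  disjoint : Empty (⁅ f zero ⁆ ∩ image (f ∘ suc))
  disjoint (x , x∈) with x∈p∩q⁻ ⁅ f zero ⁆ _ x∈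
  ... | x∈⁅f₀⁆ , x∈img with ∈image⁻ (f ∘ suc) x∈img
  ...   | i , refl with f-inj (x∈⁅y⁆⇒x≡y (f zero) x∈⁅f₀⁆)
  ...     | ()

NoThreeConcurrent : ∀ n {s} → (Fin s → Line n) → Set
NoThreeConcurrent n L =
  ∀ {i j k p} → i ≢ j → i ≢ k → j ≢ k → ¬ (p ∈ L i × p ∈ L j × p ∈ L k)

module _ {n s s′} {L : Fin s → Line n} (f : Fin s′ → Fin s) (f-inj : Injective _≡_ _≡_ f) where

  isPurePartialPlane-∘ : IsPurePartialPlane n s L → IsPurePartialPlane n s′ (L ∘ f)
  isPurePartialPlane-∘ plane = record
    { lineSize = lineSize ∘ f
    ; distinct = λ i j i≢j → distinct (f i) (f j) (i≢j ∘ f-inj)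
    ; meetOnce = λ i j i≢j → meetOnce (f i) (f j) (i≢j ∘ f-inj)
    }
    where open IsPurePartialPlane plane

  noThreeConcurrent-∘ : NoThreeConcurrent n L → NoThreeConcurrent n (L ∘ f)
  noThreeConcurrent-∘ noThree i≢j i≢k j≢k = noThree (i≢j ∘ f-inj) (i≢k ∘ f-inj) (j≢k ∘ f-inj)

module Meets {n s} {L : Fin s → Line n} (plane : IsPurePartialPlane n s L) where
  open IsPurePartialPlane plane

  private
    nonempty : ∀ {i j} (i≢j : i ≢ j) → Nonempty (L i ∩ L j)
    nonempty i≢j = 0<∣p∣⇒Nonempty (≤-reflexive (sym (meetOnce _ _ i≢j)))

  meet : ∀ {i j} → i ≢ j → Point n
  meet i≢j = proj₁ (nonempty i≢j)

  meet∈ : ∀ {i j} (i≢j : i ≢ j) → meet i≢j ∈ L i × meet i≢j ∈ L j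
  meet∈ {i} {j} i≢j = x∈p∩q⁻ (L i) (L j) (proj₂ (nonempty i≢j))

  meet-unique : ∀ {i j p} (i≢j : i ≢ j) → p ∈ L i → p ∈ L j → p ≡ meet i≢j
  meet-unique i≢j p∈Lᵢ p∈Lⱼ =
    ∣p∣≡1⇒∈-unique (meetOnce _ _ i≢j) (x∈p∩q⁺ (p∈Lᵢ , p∈Lⱼ)) (x∈p∩q⁺ (meet∈ i≢j))

-- The lines other than L i are enumerated as L (punchIn i j).
module Crossings {n s} {L : Fin (suc s) → Line n}
                 (plane : IsPurePartialPlane n (suc s) L) (noThree : NoThreeConcurrent n L) where
  open IsPurePartialPlane plane
  open Meets plane

  crossing : Fin (suc s) → Fin s → Point n
  crossing i j = meet (punchInᵢ≢i i j ∘ sym)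

  crossing∈ : ∀ i j → crossing i j ∈ L i × crossing i j ∈ L (punchIn i j)
  crossing∈ i j = meet∈ (punchInᵢ≢i i j ∘ sym)

  crossing-injective : ∀ i → Injective _≡_ _≡_ (crossing i)
  crossing-injective i {j} {j′} same with j ≟ j′
  ... | yes j≡j′ = j≡j′
  ... | no  j≢j′ = contradiction
    (proj₁ (crossing∈ i j) , proj₂ (crossing∈ i j) ,
     subst (_∈ L (punchIn i j′)) (sym same) (proj₂ (crossing∈ i j′)))
    (noThree (punchInᵢ≢i i j ∘ sym) (punchInᵢ≢i i j′ ∘ sym) (j≢j′ ∘ punchIn-injective i j j′))

  ∣crossings∣≡s : ∀ i → ∣ image (crossing i) ∣ ≡ s
  ∣crossings∣≡s i = ∣image∣≡k (crossing i) (crossing-injective i)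

  crossings⊆ : ∀ i → image (crossing i) ⊆ L i
  crossings⊆ i x∈ with ∈image⁻ (crossing i) x∈
  ... | j , refl = proj₁ (crossing∈ i j)

  lineCount≤2+n : suc s ≤ suc (suc n)
  lineCount≤2+n = s≤s (begin
    s                             ≡⟨ ∣crossings∣≡s zero ⟨
    ∣ image (crossing zero) ∣     ≤⟨ p⊆q⇒∣p∣≤∣q∣ (crossings⊆ zero) ⟩
    ∣ L zero ∣                    ≡⟨ lineSize zero ⟩
    suc n                         ∎)
    where open ≤-Reasoning

  ownPoint : s ≤ n → ∀ i → ∃ λ p → p ∈ L i × (∀ {j} → i ≢ j → p ∉ L j)
  ownPoint s≤n i with ∣q∣<∣p∣⇒∃∈p∉q (L i) (image (crossing i))
                        (subst₂ _<_ (sym (∣crossings∣≡s i)) (sym (lineSize i)) (s≤s s≤n))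
  ... | p , p∈Lᵢ , p∉crossings = p , p∈Lᵢ , λ i≢j p∈Lⱼ →
    p∉crossings (subst (_∈ image (crossing i)) (sym (p≡crossing i≢j p∈Lⱼ)) (∈image⁺ (crossing i) (punchOut i≢j)))
    where
    p≡crossing : ∀ {j} (i≢j : i ≢ j) → p ∈ L j → p ≡ crossing i (punchOut i≢j)
    p≡crossing i≢j p∈Lⱼ = meet-unique _ p∈Lᵢ (subst (λ j → p ∈ L j) (sym (punchIn-punchOut i≢j)) p∈Lⱼ)

lineCount≤2+n : ∀ {n s} {L : Fin s → Line n} → IsPurePartialPlane n s L → NoThreeConcurrent n L →
                s ≤ suc (suc n)
lineCount≤2+n {s = zero}  _     _       = z≤n
lineCount≤2+n {s = suc s} plane noThree = Crossings.lineCount≤2+n plane noThree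

ownPoints : ∀ {n s} {L : Fin s → Line n} → IsPurePartialPlane n s L → NoThreeConcurrent n L →
            s ≤ suc n → ∀ i → ∃ λ p → p ∈ L i × (∀ {j} → i ≢ j → p ∉ L j)
ownPoints {s = suc s} plane noThree (s≤s s≤n) = Crossings.ownPoint plane noThree s≤n

[1+s]C2≡s+sC2 : ∀ s → suc s C 2 ≡ s + s C 2
[1+s]C2≡s+sC2 s = trans (sym (nCk+nC[k+1]≡[n+1]C[k+1] s 1)) (cong (_+ s C 2) (nC1≡n s))

-- Peeling off line 0, which meets the other s lines in s distinct points.
∣⋃ᶠL∣+sC2≤s*[1+n] : ∀ {n s} {L : Fin s → Line n} → IsPurePartialPlane n s L → NoThreeConcurrent n L →
                    ∣ ⋃ᶠ L ∣ + s C 2 ≤ s * suc n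
∣⋃ᶠL∣+sC2≤s*[1+n] {n} {zero}  {L} _     _       =
  ≤-reflexive (trans (+-identityʳ ∣ ⋃ᶠ L ∣) (∣⊥∣≡0 (numPoints n)))
∣⋃ᶠL∣+sC2≤s*[1+n] {n} {suc s} {L} plane noThree = begin
  ∣ U ∣ + suc s C 2                 ≡⟨ cong (∣ U ∣ +_) ([1+s]C2≡s+sC2 s) ⟩
  ∣ U ∣ + (s + s C 2)               ≡⟨ +-assoc ∣ U ∣ s (s C 2) ⟨
  ∣ U ∣ + s + s C 2                 ≤⟨ +-monoˡ-≤ (s C 2) (+-monoʳ-≤ ∣ U ∣ s≤∣L₀∩U′∣) ⟩
  ∣ U ∣ + ∣ L zero ∩ U′ ∣ + s C 2   ≡⟨ cong (_+ s C 2) (∣p∪q∣+∣p∩q∣≡∣p∣+∣q∣ (L zero) U′) ⟩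
  ∣ L zero ∣ + ∣ U′ ∣ + s C 2       ≡⟨ cong (λ l → l + ∣ U′ ∣ + s C 2) (lineSize zero) ⟩
  suc n + ∣ U′ ∣ + s C 2            ≡⟨ +-assoc (suc n) ∣ U′ ∣ (s C 2) ⟩
  suc n + (∣ U′ ∣ + s C 2)          ≤⟨ +-monoʳ-≤ (suc n) (∣⋃ᶠL∣+sC2≤s*[1+n] {n} plane′ noThree′) ⟩
  suc s * suc n                     ∎
  where
  open ≤-Reasoning
  open IsPurePartialPlane plane
  open Crossings plane noThree
  U = ⋃ᶠ L
  U′ = ⋃ᶠ (L ∘ suc)
  plane′ = isPurePartialPlane-∘ {n} {L = L} suc suc-injective plane
  noThree′ = noThreeConcurrent-∘ {n} {L = L} suc suc-injective noThree
  crossings₀⊆L₀∩U′ : image (crossing zero) ⊆ L zero ∩ U′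
  crossings₀⊆L₀∩U′ x∈ with ∈image⁻ (crossing zero) x∈
  ... | j , refl = x∈p∩q⁺ (proj₁ (crossing∈ zero j) , ∈⋃ᶠ⁺ (L ∘ suc) j (proj₂ (crossing∈ zero j)))
  s≤∣L₀∩U′∣ : s ≤ ∣ L zero ∩ U′ ∣
  s≤∣L₀∩U′∣ = ≤-trans (≤-reflexive (sym (∣crossings∣≡s zero))) (p⊆q⇒∣p∣≤∣q∣ crossings₀⊆L₀∩U′)

enoughUncoveredPoints : ∀ {n s c} {L : Fin s → Line n} → IsPurePartialPlane n s L → NoThreeConcurrent n L →
                        suc s * suc n ≤ c + numPoints n + s C 2 → suc n ≤ c + ∣ ∁ (⋃ᶠ L) ∣
enoughUncoveredPoints {n} {s} {c} {L} plane noThree count =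
  +-cancelʳ-≤ (s * suc n) (suc n) (c + ∣ ∁ U ∣) (begin
    suc s * suc n                   ≤⟨ count ⟩
    c + numPoints n + s C 2         ≡⟨ cong (λ l → c + l + s C 2) ∣∁U∣+∣U∣≡numPoints ⟨
    c + (∣ ∁ U ∣ + ∣ U ∣) + s C 2   ≡⟨ rearrange c ∣ ∁ U ∣ ∣ U ∣ (s C 2) ⟩
    c + ∣ ∁ U ∣ + (∣ U ∣ + s C 2)   ≤⟨ +-monoʳ-≤ (c + ∣ ∁ U ∣) (∣⋃ᶠL∣+sC2≤s*[1+n] {n} plane noThree) ⟩
    c + ∣ ∁ U ∣ + s * suc n         ∎)
  where
  open ≤-Reasoning
  U = ⋃ᶠ L
  ∣∁U∣+∣U∣≡numPoints : ∣ ∁ U ∣ + ∣ U ∣ ≡ numPoints n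
  ∣∁U∣+∣U∣≡numPoints = trans (cong (_+ ∣ U ∣) (∣∁p∣≡n∸∣p∣ U)) (m∸n+n≡m (∣p∣≤n U))
  rearrange : ∀ a b d e → a + (b + d) + e ≡ a + b + (d + e)
  rearrange = solve-∀

record Transversal {n s} (L : Fin s → Line n) (c : ℕ) : Set where
  field
    points    : Subset (numPoints n)
    points⊆⋃ᶠ : points ⊆ ⋃ᶠ L
    meetsOnce : ∀ i → ∣ points ∩ L i ∣ ≡ 1
    size      : ∣ points ∣ ≡ c

-- Padding the transversal with uncovered points gives an (n+1)-set M meeting every line once;
-- M cannot be a line, since a line meets itself in n + 1 ≥ 2 points.
transversal⇒¬saturated : ∀ {n s c} {L : Fin s → Line n} → 1 ≤ n → Transversal {n} L c →
                         c ≤ suc n → suc n ≤ c + ∣ ∁ (⋃ᶠ L) ∣ → ¬ IsSaturated n s L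
transversal⇒¬saturated {n} {s} {c} {L} 1≤n transversal c≤1+n room saturated =
  M-not-a-line (saturated M ∣M∣≡1+n M-transversal)
  where
  open Transversal {n = n} transversal renaming (points to T)
  U = ⋃ᶠ L
  padding = subsetOfSize (∁ U) (suc n ∸ c) (m≤n+o⇒m∸n≤o (suc n) c room)
  B = proj₁ padding
  B⊆∁U : B ⊆ ∁ U
  B⊆∁U = proj₁ (proj₂ padding)
  M = T ∪ B
  T∩B-empty : Empty (T ∩ B)
  T∩B-empty (x , x∈) with x∈p∩q⁻ T B x∈
  ... | x∈T , x∈B = x∈∁p⇒x∉p (B⊆∁U x∈B) (points⊆⋃ᶠ x∈T)
  ∣M∣≡1+n : ∣ M ∣ ≡ suc n
  ∣M∣≡1+n = begin
    ∣ T ∪ B ∣          ≡⟨ ∣p∪q∣≡∣p∣+∣q∣ T B T∩B-empty ⟩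
    ∣ T ∣ + ∣ B ∣      ≡⟨ cong₂ _+_ size (proj₂ (proj₂ padding)) ⟩
    c + (suc n ∸ c)    ≡⟨ m+[n∸m]≡n c≤1+n ⟩
    suc n              ∎
    where open ≡-Reasoning
  B∩Lᵢ≡⊥ : ∀ i → B ∩ L i ≡ ⊥
  B∩Lᵢ≡⊥ i = Empty-unique λ (x , x∈) → let (x∈B , x∈Lᵢ) = x∈p∩q⁻ B (L i) x∈ in
    x∈∁p⇒x∉p (B⊆∁U x∈B) (∈⋃ᶠ⁺ L i x∈Lᵢ)
  M-transversal : ∀ i → ∣ M ∩ L i ∣ ≡ 1
  M-transversal i = begin
    ∣ (T ∪ B) ∩ L i ∣          ≡⟨ cong ∣_∣ (∩-distribʳ-∪ (L i) T B) ⟩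
    ∣ T ∩ L i ∪ B ∩ L i ∣      ≡⟨ cong (λ X → ∣ T ∩ L i ∪ X ∣) (B∩Lᵢ≡⊥ i) ⟩
    ∣ T ∩ L i ∪ ⊥ ∣            ≡⟨ cong ∣_∣ (∪-identityʳ (T ∩ L i)) ⟩
    ∣ T ∩ L i ∣                ≡⟨ meetsOnce i ⟩
    1                          ∎
    where open ≡-Reasoning
  M-not-a-line : ¬ (∃ λ i → M ≡ L i)
  M-not-a-line (i , M≡Lᵢ) = <⇒≢ (s≤s 1≤n) (begin
    1                 ≡⟨ M-transversal i ⟨
    ∣ M ∩ L i ∣       ≡⟨ cong (λ X → ∣ M ∩ X ∣) M≡Lᵢ ⟨
    ∣ M ∩ M ∣         ≡⟨ cong ∣_∣ (∩-idem M) ⟩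
    ∣ M ∣             ≡⟨ ∣M∣≡1+n ⟩
    suc n             ∎)
    where open ≡-Reasoning

module LabelledPoints {n s c} {L : Fin s → Line n}
  (f : Fin c → Point n) (label : Fin s → Fin c)
  (f-label∈ : ∀ i → f (label i) ∈ L i)
  (f∈⇒label : ∀ {a i} → f a ∈ L i → a ≡ label i)
  (label-surjective : ∀ a → ∃ λ i → label i ≡ a) where

  f-injective : Injective _≡_ _≡_ f
  f-injective {a} {a′} fa≡fa′ with label-surjective a′
  ... | i , refl = f∈⇒label (subst (_∈ L i) (sym fa≡fa′) (f-label∈ i))

  image⊆⋃ᶠ : image f ⊆ ⋃ᶠ L
  image⊆⋃ᶠ x∈ with ∈image⁻ f x∈
  ... | a , refl with label-surjective a
  ...   | i , refl = ∈⋃ᶠ⁺ L i (f-label∈ i)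

  ∣image∩L∣≡1 : ∀ i → ∣ image f ∩ L i ∣ ≡ 1
  ∣image∩L∣≡1 i = ∈-unique⇒∣p∣≡1 (x∈p∩q⁺ (∈image⁺ f (label i) , f-label∈ i)) unique
    where
    unique : ∀ {x} → x ∈ image f ∩ L i → x ≡ f (label i)
    unique x∈ with x∈p∩q⁻ (image f) (L i) x∈
    ... | x∈img , x∈Lᵢ with ∈image⁻ f x∈img
    ...   | a , refl = cong f (f∈⇒label x∈Lᵢ)

  transversal : Transversal {n} L c
  transversal = record
    { points    = image f
    ; points⊆⋃ᶠ = image⊆⋃ᶠ
    ; meetsOnce = ∣image∩L∣≡1
    ; size      = ∣image∣≡k f f-injective
    }

ownPointTransversal : ∀ {n s} {L : Fin s → Line n} → IsPurePartialPlane n s L → NoThreeConcurrent n L →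
                      s ≤ suc n → Transversal {n} L s
ownPointTransversal {n} {s} {L} plane noThree s≤1+n =
  LabelledPoints.transversal {n} own id (proj₁ ∘ proj₂ ∘ ownPoints plane noThree s≤1+n) own∈⇒ (λ i → i , refl)
  where
  own : Fin s → Point n
  own i = proj₁ (ownPoints plane noThree s≤1+n i)
  own∈⇒ : ∀ {a i} → own a ∈ L i → a ≡ i
  own∈⇒ {a} {i} own∈Lᵢ with a ≟ i
  ... | yes a≡i = a≡i
  ... | no  a≢i = contradiction own∈Lᵢ (proj₂ (proj₂ (ownPoints plane noThree s≤1+n a)) a≢i)

-- The a-th pair consists of the lines combine a 0 and combine a 1.
pairTransversal : ∀ {n s c} {L : Fin s → Line n} → IsPurePartialPlane n s L → NoThreeConcurrent n L →
                  s ≡ c * 2 → Transversal {n} L c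
pairTransversal {n} {c = c} {L} plane noThree refl =
  LabelledPoints.transversal {n} pairPoint (quotient 2) pairPoint-label∈ pairPoint∈⇒ label-surjective
  where
  open Meets plane
  quotient-combine : ∀ a b → quotient 2 (combine a b) ≡ a
  quotient-combine a b = cong proj₁ (remQuot-combine a b)
  partners-differ : ∀ a → combine a zero ≢ combine a (suc zero)
  partners-differ a eq with combine-injectiveʳ a zero a (suc zero) eq
  ... | ()
  pairPoint : Fin c → Point n
  pairPoint a = meet (partners-differ a)
  pairPoint∈ : ∀ a b → pairPoint a ∈ L (combine a b)
  pairPoint∈ a zero       = proj₁ (meet∈ (partners-differ a))
  pairPoint∈ a (suc zero) = proj₂ (meet∈ (partners-differ a))
  pairPoint-label∈ : ∀ i → pairPoint (quotient 2 i) ∈ L i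
  pairPoint-label∈ i = subst (λ j → pairPoint (quotient 2 i) ∈ L j) (combine-remQuot {c} 2 i)
                             (pairPoint∈ (quotient 2 i) (remainder {c} 2 i))
  pairPoint∈⇒ : ∀ {a i} → pairPoint a ∈ L i → a ≡ quotient 2 i
  pairPoint∈⇒ {a} {i} pairPoint∈Lᵢ with a ≟ quotient 2 i
  ... | yes a≡ = a≡
  ... | no  a≢ = contradiction (pairPoint∈ a zero , pairPoint∈ a (suc zero) , pairPoint∈Lᵢ)
                   (noThree (partners-differ a) (not-partner zero) (not-partner (suc zero)))
    where
    not-partner : ∀ b → combine a b ≢ i
    not-partner b refl = a≢ (sym (quotient-combine a b))
  label-surjective : ∀ a → ∃ λ i → quotient 2 i ≡ a
  label-surjective a = combine a zero , quotient-combine a zero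

[1+s][1+n]≤s+N+sC2 : ∀ n s → s ≤ suc n → suc s * suc n ≤ s + numPoints n + s C 2
[1+s][1+n]≤s+N+sC2 n s s≤1+n with m≤n⇒m<n∨m≡n s≤1+n
... | inj₁ (s≤s s≤n) = begin
  suc s * suc n              ≡⟨ lhs≡ n s ⟩
  s + (s * n + suc n)        ≤⟨ +-monoʳ-≤ s (+-monoˡ-≤ (suc n) (*-monoˡ-≤ n s≤n)) ⟩
  s + (n * n + suc n)        ≡⟨ rhs≡ n s ⟩
  s + numPoints n            ≤⟨ m≤m+n (s + numPoints n) (s C 2) ⟩
  s + numPoints n + s C 2    ∎
  where
  open ≤-Reasoning
  lhs≡ : ∀ n s → suc s * suc n ≡ s + (s * n + suc n)
  lhs≡ = solve-∀
  rhs≡ : ∀ n s → s + (n * n + suc n) ≡ s + (n * n + n + 1)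
  rhs≡ = solve-∀
... | inj₂ refl = begin
  suc (suc n) * suc n                ≡⟨ lhs≡ n ⟩
  suc n + numPoints n + n            ≤⟨ +-monoʳ-≤ (suc n + numPoints n) (m≤m+n n (n C 2)) ⟩
  suc n + numPoints n + (n + n C 2)  ≡⟨ cong (suc n + numPoints n +_) ([1+s]C2≡s+sC2 n) ⟨
  suc n + numPoints n + suc n C 2    ∎
  where
  open ≤-Reasoning
  lhs≡ : ∀ n → suc (suc n) * suc n ≡ suc n + (n * n + n + 1) + n
  lhs≡ = solve-∀

[2+2m]C2≡[1+m][1+2m] : ∀ m → suc (suc (2 * m)) C 2 ≡ suc m * suc (2 * m)
[2+2m]C2≡[1+m][1+2m] zero    = refl
[2+2m]C2≡[1+m][1+2m] (suc m) = begin
  suc (suc (2 * suc m)) C 2                       ≡⟨ cong (λ l → suc (suc l) C 2) (2[1+m]≡2+2m m) ⟩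
  suc (suc a) C 2                                 ≡⟨ [1+s]C2≡s+sC2 (suc a) ⟩
  suc a + suc a C 2                               ≡⟨ cong (suc a +_) ([1+s]C2≡s+sC2 a) ⟩
  suc a + (a + a C 2)                             ≡⟨ cong (λ l → suc a + (a + l)) ([2+2m]C2≡[1+m][1+2m] m) ⟩
  suc a + (a + suc m * suc (2 * m))               ≡⟨ step m ⟩
  suc (suc m) * suc (2 * suc m)                   ∎
  where
  open ≡-Reasoning
  a = suc (suc (2 * m))
  2[1+m]≡2+2m : ∀ m → 2 * suc m ≡ suc (suc (2 * m))
  2[1+m]≡2+2m = solve-∀
  step : ∀ m → suc (suc (suc (2 * m))) + (suc (suc (2 * m)) + suc m * suc (2 * m))
               ≡ suc (suc m) * suc (2 * suc m)
  step = solve-∀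

[3+2m][1+2m]≤1+m+N+[2+2m]C2 : ∀ m →
  suc (suc (suc (2 * m))) * suc (2 * m) ≤ suc m + numPoints (2 * m) + suc (suc (2 * m)) C 2
[3+2m][1+2m]≤1+m+N+[2+2m]C2 zero    = ≤-refl
[3+2m][1+2m]≤1+m+N+[2+2m]C2 (suc m) = begin
  suc (suc (suc n)) * suc n                       ≤⟨ m≤m+n (suc (suc (suc n)) * suc n) (2 * suc m * m) ⟩
  suc (suc (suc n)) * suc n + 2 * suc m * m       ≡⟨ count≡ m ⟩
  suc (suc m) + numPoints n + suc (suc m) * suc n ≡⟨ cong (suc (suc m) + numPoints n +_)
                                                          ([2+2m]C2≡[1+m][1+2m] (suc m)) ⟨
  suc (suc m) + numPoints n + suc (suc n) C 2     ∎
  where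
  open ≤-Reasoning
  n = 2 * suc m
  count≡ : ∀ m → suc (suc (suc (2 * suc m))) * suc (2 * suc m) + 2 * suc m * m
                 ≡ suc (suc m) + (2 * suc m * (2 * suc m) + 2 * suc m + 1) + suc (suc m) * suc (2 * suc m)
  count≡ = solve-∀

∈linesThrough : ∀ {n s} {L : Fin s → Line n} {p i} → p ∈ L i → i ∈ linesThrough n L p
∈linesThrough {n} {L = L} {p} {i} p∈Lᵢ =
  lookup⇒[]= i _ (trans (lookup∘tabulate (λ j → lookup (L j) p) i) ([]=⇒lookup p∈Lᵢ))

concurrent⇒3≤∣linesThrough∣ : ∀ {n s} {L : Fin s → Line n} {p i j k} → i ≢ j → i ≢ k → j ≢ k →
                              p ∈ L i → p ∈ L j → p ∈ L k → 3 ≤ ∣ linesThrough n L p ∣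
concurrent⇒3≤∣linesThrough∣ {n} {L = L} {p} {i} {j} {k} i≢j i≢k j≢k p∈Lᵢ p∈Lⱼ p∈Lₖ =
  ≤-trans (s≤s (≤-trans (s≤s (x∈p⇒0<∣p∣ k∈P-i-j)) (x∈p⇒∣p-x∣<∣p∣ j∈P-i))) (x∈p⇒∣p-x∣<∣p∣ i∈P)
  where
  P = linesThrough n L p
  i∈P : i ∈ P
  i∈P = ∈linesThrough {n} {L = L} p∈Lᵢ
  j∈P-i : j ∈ P - i
  j∈P-i = x∈p∧x≢y⇒x∈p-y (∈linesThrough {n} {L = L} p∈Lⱼ) (i≢j ∘ sym)
  k∈P-i-j : k ∈ P - i - j
  k∈P-i-j = x∈p∧x≢y⇒x∈p-y (x∈p∧x≢y⇒x∈p-y (∈linesThrough {n} {L = L} p∈Lₖ) (i≢k ∘ sym)) (j≢k ∘ sym)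

even-saturated⇒¬noThreeConcurrent : ∀ {n m s} {L : Fin s → Line n} → 1 ≤ n → n ≡ 2 * m →
                                    IsPurePartialPlane n s L → IsSaturated n s L → ¬ NoThreeConcurrent n L
even-saturated⇒¬noThreeConcurrent {n} {m} {s} 1≤n refl plane saturated noThree
  with m≤n⇒m<n∨m≡n (lineCount≤2+n {n} plane noThree)
... | inj₁ (s≤s s≤1+n) =
  transversal⇒¬saturated {n} 1≤n (ownPointTransversal plane noThree s≤1+n) s≤1+n
    (enoughUncoveredPoints {n} plane noThree ([1+s][1+n]≤s+N+sC2 n s s≤1+n)) saturated
... | inj₂ refl =
  transversal⇒¬saturated {n} 1≤n (pairTransversal plane noThree (cong (2 +_) (*-comm 2 m))) (s≤s (m≤n*m m 2))
    (enoughUncoveredPoints {n} plane noThree ([3+2m][1+2m]≤1+m+N+[2+2m]C2 m)) saturated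

theorem2 : (n : ℕ) → 2 ≤ n → (∃ λ k → n ≡ 2 * k) →
    (s : ℕ) → (L : Fin s → Line n) →
    IsPurePartialPlane n s L → IsSaturated n s L →
    ∃ λ (p : Point n) → 3 ≤ ∣ linesThrough n L p ∣
theorem2 n 2≤n (m , n≡2m) s L plane saturated with any? (λ p → 3 ≤? ∣ linesThrough n L p ∣)
... | yes triplePoint = triplePoint
... | no  noTriplePoint =
  ⊥-elim (even-saturated⇒¬noThreeConcurrent {n} {m} (<⇒≤ 2≤n) n≡2m plane saturated noThree)
  where
  noThree : NoThreeConcurrent n L
  noThree i≢j i≢k j≢k (p∈Lᵢ , p∈Lⱼ , p∈Lₖ) =
    noTriplePoint (_ , concurrent⇒3≤∣linesThrough∣ {n} {L = L} i≢j i≢k j≢k p∈Lᵢ p∈Lⱼ p∈Lₖ)
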